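{- Let $k\geq 3$ and let $G$ be a pseudo $k$-regular graph. Let $ij$ be an edge of $G$ with $2\leq d_j<k$. Then $$2\leq d_i\leq k^2-3k+4,$$ with equality in the second inequality if and only if $d_j=k-1$ and all neighbors of $j$ other than $i$ have degree $2$.
   Context: All graphs are finite, simple and without isolated vertices. For a vertex $i$, $d_i$ is its degree and $m_i=d_i^{ -1}\sum_{j:\, ji\in E(G)} d_j$ is its average $2$-degree. A graph is $k$-harmonic if $m_i=k$ for all vertices $i$; it is pseudo $k$-regular if it is $k$-harmonic but not $k$-regular. -}

module Defs where

open import Data.Nat using (ℕ; zero; suc; _+_; _*_; _≤_; _<_)
open import Data.Fin using (Fin)
open import Data.Bool using (Bool; true; false; if_then_else_)
open import Data.List using (List; map)
open import Data.Nat.ListAction using (sum)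
open import Data.List.Base using (allFin)
open import Data.Product using (_×_; Σ; ∃)
open import Relation.Binary.PropositionalEquality using (_≡_)
open import Relation.Nullary using (¬_)

record Graph (n : ℕ) : Set where
  field
    adj   : Fin n → Fin n → Bool
    sym   : ∀ i j → adj i j ≡ adj j i
    irrefl : ∀ i → adj i i ≡ false

open Graph public

nbSum : ∀ {n} → Graph n → Fin n → (Fin n → ℕ) → ℕ
nbSum G i f = sum (map (λ j → if adj G i j then f j else 0) (allFin _))

deg : ∀ {n} → Graph n → Fin n → ℕ
deg G i = nbSum G i (λ _ → 1)

deg2Sum : ∀ {n} → Graph n → Fin n → ℕ
deg2Sum G i = nbSum G i (deg G)

NoIsolated : ∀ {n} → Graph n → Set
NoIsolated G = ∀ i → 1 ≤ deg G i

-- k-harmonic: m_i = k for every vertex, i.e. Σ_{j ~ i} d_j = k * d_i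
-- (m_i = d_i⁻¹ Σ_{j~i} d_j, and d_i ≥ 1, so this is m_i = k multiplied through by d_i)
Harmonic : ∀ {n} → Graph n → ℕ → Set
Harmonic G k = ∀ i → deg2Sum G i ≡ k * deg G i

Regular : ∀ {n} → Graph n → ℕ → Set
Regular G k = ∀ i → deg G i ≡ k

PseudoRegular : ∀ {n} → Graph n → ℕ → Set
PseudoRegular G k = Harmonic G k × ¬ Regular G k

Adj : ∀ {n} → Graph n → Fin n → Fin n → Set
Adj G i j = adj G i j ≡ true

module Submission where

-- No neighbour of j is a leaf, because the unique neighbour of a leaf in a
-- k-harmonic graph has degree k.  So every neighbour l of j has d_l ≥ 2, and
-- harmonicity at j, k·d_j = Σ_{l~j} d_l = 2·d_j + Σ_{l~j} (d_l − 2), says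
-- that the total excess over 2 around j is (k − 2)·d_j.

open import Defs hiding (sym)
open import Data.Nat using (ℕ; zero; suc; _+_; _*_; _∸_; _≤_; _<_; s≤s; s≤s⁻¹)
open import Data.Nat.Properties
  using ( +-*-semiring; +-identityʳ; *-identityʳ; *-zeroʳ; *-distribʳ-+
        ; m+n≡0⇒m≡0; m+n≡0⇒n≡0; m+[n∸m]≡n; m+n∸n≡m; m∸n≡0⇒m≤n; m≤m+n
        ; *-monoʳ-≤; +-monoʳ-≤; +-cancelˡ-≤; +-cancelˡ-≡; *-cancelˡ-≡
        ; ≤-antisym; n≤0⇒n≡0; m≤n⇒m<n∨m≡n; <-irrefl; suc-injective
        ; module ≤-Reasoning )
open import Data.Nat.ListAction using (sum)
open import Data.Nat.Tactic.RingSolver using (solve-∀)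
open import Algebra.Properties.Semiring.Sum +-*-semiring
  using (sum-cong-≗; sum-replicate-zero; sum-remove; ∑-distrib-+; *-distribˡ-sum)
  renaming (sum to ∑)
open import Data.Fin using (Fin; zero; suc; punchIn; punchOut)
open import Data.Fin.Properties using (punchInᵢ≢i; punchIn-punchOut)
open import Data.Vec.Functional using (removeAt)
open import Data.Bool using (true; false; if_then_else_)
open import Data.List using (tabulate)
open import Data.List.Properties using (map-tabulate)
open import Data.Product using (_×_; _,_; proj₁; proj₂)
open import Data.Product.Function.NonDependent.Propositional using (_×-⇔_)
open import Data.Sum using (inj₁; inj₂)
open import Function using (id; _∘_)
open import Function.Bundles using (_⇔_; mk⇔; Equivalence)
open import Function.Construct.Identity using (⇔-id)
open import Function.Construct.Symmetry using (⇔-sym)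
open import Function.Construct.Composition using (_⇔-∘_)
open import Relation.Nullary using (contradiction)
open import Relation.Binary.PropositionalEquality
  using (_≡_; _≢_; refl; sym; trans; cong; cong₂; subst; module ≡-Reasoning)

sum-tabulate : ∀ {n} (h : Fin n → ℕ) → sum (tabulate h) ≡ ∑ h
sum-tabulate {zero}  h = refl
sum-tabulate {suc n} h = cong (h zero +_) (sum-tabulate (h ∘ suc))

∑≡0⇔ : ∀ {n} (h : Fin n → ℕ) → ∑ h ≡ 0 ⇔ (∀ x → h x ≡ 0)
∑≡0⇔ {n} h = mk⇔ (termsVanish h) (λ zeros → trans (sum-cong-≗ zeros) (sum-replicate-zero n))
  where
  termsVanish : ∀ {m} (g : Fin m → ℕ) → ∑ g ≡ 0 → ∀ x → g x ≡ 0
  termsVanish g eq zero    = m+n≡0⇒m≡0 (g zero) eq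
  termsVanish g eq (suc x) = termsVanish (g ∘ suc) (m+n≡0⇒n≡0 (g zero) eq) x

∑-except : ∀ {n} → Fin n → (Fin n → ℕ) → ℕ
∑-except {suc n} i h = ∑ (removeAt h i)

∑-pick : ∀ {n} (i : Fin n) (h : Fin n → ℕ) → ∑ h ≡ h i + ∑-except i h
∑-pick {suc n} i h = sum-remove {i = i} h

∑-except≡0⇔ : ∀ {n} (i : Fin n) (h : Fin n → ℕ) → ∑-except i h ≡ 0 ⇔ (∀ l → l ≢ i → h l ≡ 0)
∑-except≡0⇔ {suc n} i h = mk⇔ to from
  where
  to : ∑ (removeAt h i) ≡ 0 → ∀ l → l ≢ i → h l ≡ 0
  to eq l l≢i = subst (λ x → h x ≡ 0) (punchIn-punchOut i≢l)
                  (Equivalence.to (∑≡0⇔ (removeAt h i)) eq (punchOut i≢l))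
    where
    i≢l : i ≢ l
    i≢l = l≢i ∘ sym
  from : (∀ l → l ≢ i → h l ≡ 0) → ∑ (removeAt h i) ≡ 0
  from zeros = Equivalence.from (∑≡0⇔ (removeAt h i)) (λ x → zeros (punchIn i x) (punchInᵢ≢i i x))

nbTerm : ∀ {n} → Graph n → Fin n → (Fin n → ℕ) → Fin n → ℕ
nbTerm G i f x = if adj G i x then f x else 0

nbTerm-adj : ∀ {n} (G : Graph n) {i x} (f : Fin n → ℕ) → Adj G i x → nbTerm G i f x ≡ f x
nbTerm-adj G f i~x = cong (λ b → if b then _ else 0) i~x

nbTerm-absent : ∀ {n} (G : Graph n) {i x} (f : Fin n → ℕ) → nbTerm G i (λ _ → 1) x ≡ 0 → nbTerm G i f x ≡ 0
nbTerm-absent G {i} {x} f absent with adj G i x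
... | false = refl
... | true  = contradiction absent λ ()

nbSum-∑ : ∀ {n} (G : Graph n) i (f : Fin n → ℕ) → nbSum G i f ≡ ∑ (nbTerm G i f)
nbSum-∑ G i f = trans (cong sum (map-tabulate id (nbTerm G i f))) (sum-tabulate (nbTerm G i f))

adj-sym : ∀ {n} (G : Graph n) {i j} → Adj G i j → Adj G j i
adj-sym G {i} {j} i~j = trans (Graph.sym G j i) i~j

nbSum-split : ∀ {n} (G : Graph n) {j i} (f : Fin n → ℕ) → Adj G j i →
  nbSum G j f ≡ f i + ∑-except i (nbTerm G j f)
nbSum-split G {j} {i} f j~i = begin
  nbSum G j f                                ≡⟨ nbSum-∑ G j f ⟩
  ∑ (nbTerm G j f)                           ≡⟨ ∑-pick i (nbTerm G j f) ⟩
  nbTerm G j f i + ∑-except i (nbTerm G j f) ≡⟨ cong (_+ ∑-except i (nbTerm G j f)) (nbTerm-adj G f j~i) ⟩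
  f i + ∑-except i (nbTerm G j f)            ∎
  where open ≡-Reasoning

degree-one-nbSum : ∀ {n} (G : Graph n) {x j} (f : Fin n → ℕ) → deg G x ≡ 1 → Adj G x j → nbSum G x f ≡ f j
degree-one-nbSum G {x} {j} f dx≡1 x~j = begin
  nbSum G x f                     ≡⟨ nbSum-split G f x~j ⟩
  f j + ∑-except j (nbTerm G x f) ≡⟨ cong (f j +_) (Equivalence.from (∑-except≡0⇔ j (nbTerm G x f)) othersVanish) ⟩
  f j + 0                         ≡⟨ +-identityʳ (f j) ⟩
  f j                             ∎
  where
  open ≡-Reasoning
  noOtherNeighbour : ∀ l → l ≢ j → nbTerm G x (λ _ → 1) l ≡ 0
  noOtherNeighbour = Equivalence.to (∑-except≡0⇔ j _) (suc-injective (trans (sym (nbSum-split G _ x~j)) dx≡1))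
  othersVanish : ∀ l → l ≢ j → nbTerm G x f l ≡ 0
  othersVanish l l≢j = nbTerm-absent G f (noOtherNeighbour l l≢j)

leaf-neighbour-degree : ∀ {n} (G : Graph n) {k x j} → Harmonic G k → deg G x ≡ 1 → Adj G x j → deg G j ≡ k
leaf-neighbour-degree G {k} {x} {j} harmonic dx≡1 x~j = begin
  deg G j      ≡⟨ sym (degree-one-nbSum G (deg G) dx≡1 x~j) ⟩
  deg2Sum G x  ≡⟨ harmonic x ⟩
  k * deg G x  ≡⟨ cong (k *_) dx≡1 ⟩
  k * 1        ≡⟨ *-identityʳ k ⟩
  k            ∎
  where open ≡-Reasoning

low-degree-neighbours : ∀ {n} (G : Graph n) {k j} → Harmonic G k → NoIsolated G → deg G j < k →
  ∀ l → Adj G j l → 2 ≤ deg G l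
low-degree-neighbours G harmonic noIsolated dj<k l j~l with m≤n⇒m<n∨m≡n (noIsolated l)
... | inj₁ 2≤dl = 2≤dl
... | inj₂ 1≡dl = contradiction dj<k (<-irrefl (leaf-neighbour-degree G harmonic (sym 1≡dl) (adj-sym G j~l)))

nbSum-excess : ∀ {n} (G : Graph n) j c (f : Fin n → ℕ) → (∀ l → Adj G j l → c ≤ f l) →
  nbSum G j f ≡ c * deg G j + nbSum G j (λ l → f l ∸ c)
nbSum-excess G j c f c≤f = begin
  nbSum G j f                                     ≡⟨ nbSum-∑ G j f ⟩
  ∑ (nbTerm G j f)                                ≡⟨ sum-cong-≗ termwise ⟩
  ∑ (λ x → c * nbTerm G j one x + nbTerm G j excess x)
                                                  ≡⟨ ∑-distrib-+ (λ x → c * nbTerm G j one x) (nbTerm G j excess) ⟩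
  ∑ (λ x → c * nbTerm G j one x) + ∑ (nbTerm G j excess)
                                                  ≡⟨ cong₂ _+_ (sym (*-distribˡ-sum c (nbTerm G j one))) (sym (nbSum-∑ G j excess)) ⟩
  c * ∑ (nbTerm G j one) + nbSum G j excess       ≡⟨ cong (λ s → c * s + nbSum G j excess) (sym (nbSum-∑ G j one)) ⟩
  c * deg G j + nbSum G j excess                  ∎
  where
  open ≡-Reasoning
  one excess : Fin _ → ℕ
  one _ = 1
  excess l = f l ∸ c
  termwise : ∀ x → nbTerm G j f x ≡ c * nbTerm G j one x + nbTerm G j excess x
  termwise x with adj G j x in j~x
  ... | true  = sym (trans (cong (_+ excess x) (*-identityʳ c)) (m+[n∸m]≡n (c≤f x j~x)))
  ... | false = sym (trans (+-identityʳ (c * 0)) (*-zeroʳ c))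

otherExcess : ∀ {n} → Graph n → Fin n → Fin n → ℕ
otherExcess G j i = ∑-except i (nbTerm G j (λ l → deg G l ∸ 2))

edge-identity : ∀ {n} (G : Graph n) c {i j} → Harmonic G (2 + c) → (∀ l → Adj G j l → 2 ≤ deg G l) →
  Adj G j i → (deg G i ∸ 2) + otherExcess G j i ≡ c * deg G j
edge-identity G c {i} {j} harmonic nbrs j~i = +-cancelˡ-≡ (2 * deg G j) _ _ (begin
  2 * deg G j + (deg G i ∸ 2 + otherExcess G j i) ≡⟨ cong (2 * deg G j +_) (sym (nbSum-split G excess j~i)) ⟩
  2 * deg G j + nbSum G j excess                 ≡⟨ sym (nbSum-excess G j 2 (deg G) nbrs) ⟩
  deg2Sum G j                                    ≡⟨ harmonic j ⟩
  (2 + c) * deg G j                              ≡⟨ *-distribʳ-+ (deg G j) 2 c ⟩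
  2 * deg G j + c * deg G j                      ∎)
  where
  open ≡-Reasoning
  excess : Fin _ → ℕ
  excess l = deg G l ∸ 2

otherExcess≡0⇔ : ∀ {n} (G : Graph n) {i j} → (∀ l → Adj G j l → 2 ≤ deg G l) →
  otherExcess G j i ≡ 0 ⇔ (∀ l → Adj G j l → l ≢ i → deg G l ≡ 2)
otherExcess≡0⇔ G {i} {j} nbrs = mk⇔ to from
  where
  excess : Fin _ → ℕ
  excess l = deg G l ∸ 2
  vanishing : otherExcess G j i ≡ 0 ⇔ (∀ l → l ≢ i → nbTerm G j excess l ≡ 0)
  vanishing = ∑-except≡0⇔ i (nbTerm G j excess)
  to : otherExcess G j i ≡ 0 → ∀ l → Adj G j l → l ≢ i → deg G l ≡ 2
  to eq l j~l l≢i = ≤-antisym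
    (m∸n≡0⇒m≤n (trans (sym (nbTerm-adj G excess j~l)) (Equivalence.to vanishing eq l l≢i)))
    (nbrs l j~l)
  from : (∀ l → Adj G j l → l ≢ i → deg G l ≡ 2) → otherExcess G j i ≡ 0
  from degree2 = Equivalence.from vanishing termVanishes
    where
    termVanishes : ∀ l → l ≢ i → nbTerm G j excess l ≡ 0
    termVanishes l l≢i with adj G j l in j~l
    ... | true  = cong (_∸ 2) (degree2 l j~l l≢i)
    ... | false = refl

bounded-share : ∀ c m d s e → s + e ≡ suc c * d → d ≤ m →
  s ≤ suc c * m × (s ≡ suc c * m ⇔ (d ≡ m × e ≡ 0))
bounded-share c m d s e split d≤m = s≤cm , mk⇔ to from
  where
  open ≤-Reasoning
  cd≤cm : suc c * d ≤ suc c * m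
  cd≤cm = *-monoʳ-≤ (suc c) d≤m
  s≤cm : s ≤ suc c * m
  s≤cm = begin s ≤⟨ m≤m+n s e ⟩ s + e ≡⟨ split ⟩ suc c * d ≤⟨ cd≤cm ⟩ suc c * m ∎
  to : s ≡ suc c * m → d ≡ m × e ≡ 0
  to refl = d≡m , e≡0
    where
    e≡0 : e ≡ 0
    e≡0 = n≤0⇒n≡0 (+-cancelˡ-≤ (suc c * m) e 0
            (begin s + e ≡⟨ split ⟩ suc c * d ≤⟨ cd≤cm ⟩ suc c * m ≡⟨ +-identityʳ _ ⟨ suc c * m + 0 ∎))
    d≡m : d ≡ m
    d≡m = *-cancelˡ-≡ d m (suc c) (trans (sym split) (trans (cong (s +_) e≡0) (+-identityʳ s)))
  from : d ≡ m × e ≡ 0 → s ≡ suc c * m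
  from (refl , refl) = trans (sym (+-identityʳ s)) split

shift-by-2 : ∀ {x y} → 2 ≤ x → (x ∸ 2 ≤ y → x ≤ 2 + y) × (x ∸ 2 ≡ y ⇔ x ≡ 2 + y)
shift-by-2 {x} 2≤x =
  (λ le → subst (_≤ _) (m+[n∸m]≡n 2≤x) (+-monoʳ-≤ 2 le)) ,
  mk⇔ (λ eq → trans (sym (m+[n∸m]≡n 2≤x)) (cong (2 +_) eq)) (cong (_∸ 2))

k²-3k+4 : ∀ a → (3 + a) * (3 + a) + 4 ∸ 3 * (3 + a) ≡ 2 + suc a * (2 + a)
k²-3k+4 a = trans (cong (_∸ 3 * (3 + a)) (expand a)) (m+n∸n≡m _ (3 * (3 + a)))
  where
  expand : ∀ a → (3 + a) * (3 + a) + 4 ≡ (2 + suc a * (2 + a)) + 3 * (3 + a)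
  expand = solve-∀

lemma4p8 : (k n : ℕ) → 3 ≤ k → (G : Graph n) → NoIsolated G → PseudoRegular G k →
    (i j : Fin n) → Adj G i j → 2 ≤ deg G j → deg G j < k →
    (2 ≤ deg G i × deg G i ≤ k * k + 4 ∸ 3 * k) ×
    ((deg G i ≡ k * k + 4 ∸ 3 * k) ⇔
      (deg G j ≡ k ∸ 1 × (∀ l → Adj G j l → l ≢ i → deg G l ≡ 2)))
lemma4p8 _ _ (s≤s (s≤s (s≤s {n = a} _))) G noIsolated (harmonic , _) i j i~j _ dj<k =
  (2≤di , subst (deg G i ≤_) (sym (k²-3k+4 a)) (proj₁ shift (proj₁ share))) ,
  subst (λ t → (deg G i ≡ t) ⇔ (deg G j ≡ 2 + a × OthersOfDegree2)) (sym (k²-3k+4 a))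
    ((⇔-id _ ×-⇔ otherExcess≡0⇔ G nbrs) ⇔-∘ (proj₂ share ⇔-∘ ⇔-sym (proj₂ shift)))
  where
  OthersOfDegree2 : Set
  OthersOfDegree2 = ∀ l → Adj G j l → l ≢ i → deg G l ≡ 2
  j~i : Adj G j i
  j~i = adj-sym G i~j
  nbrs : ∀ l → Adj G j l → 2 ≤ deg G l
  nbrs = low-degree-neighbours G harmonic noIsolated dj<k
  2≤di : 2 ≤ deg G i
  2≤di = nbrs i j~i
  shift : (deg G i ∸ 2 ≤ suc a * (2 + a) → deg G i ≤ 2 + suc a * (2 + a)) ×
          (deg G i ∸ 2 ≡ suc a * (2 + a) ⇔ deg G i ≡ 2 + suc a * (2 + a))
  shift = shift-by-2 2≤di
  share : deg G i ∸ 2 ≤ suc a * (2 + a) ×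
          (deg G i ∸ 2 ≡ suc a * (2 + a) ⇔ (deg G j ≡ 2 + a × otherExcess G j i ≡ 0))
  share = bounded-share a (2 + a) (deg G j) (deg G i ∸ 2) (otherExcess G j i)
            (edge-identity G (suc a) harmonic nbrs j~i) (s≤s⁻¹ dj<k)
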